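{- Let $\lambda=(a,b)$ with $a\ge b\ge1$, and let $\mu=(\mu_1,\dots,\mu_M)$ be a content with $\sum_i\mu_i=a+b$ such that $\mu_i=2$ for exactly $m$ indices $i$ and $\mu_i=1$ for the remaining $a+b-2m$ indices. Then for every $k\ge0$, $$\vert S_k(\lambda,\mu)\vert=\frac{a-b+1+2k}{a+1+k-m}\binom{a+b-2m}{b-k-m}.$$
   Context: $S_k(\lambda,\mu)$ is the set of fillings of the two-row Young diagram of shape $(a,b)$ (top row length $a$) with content $\mu$ (exactly $\mu_v$ copies of value $v$), strictly increasing along rows, having exactly $k$ inversion pairs. For two cells in the same column with entries $i<j$, with $i_k,j_k$ the entries $k$ boxes to their right, $(i,j)$ is an inversion pair if: (1) $i_1$ or $j_1$ does not exist and $i$ is below $j$; or (2) $i_1>j_1$; or (3) $i_k=j_k$ for $1\le k\le n$, $i_{n+1}$ or $j_{n+1}$ does not exist, and $i$ is below $j$; or (4) $i_k=j_k$ for $1\le k\le n$ and $i_{n+1}>j_{n+1}$. Inversion pairs are counted as pairs of cells. Binomial coefficients with negative lower index are $0$. -}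

module Defs where

open import Data.Bool using (Bool; true; false; _∧_; if_then_else_)
open import Data.Nat using (ℕ; zero; suc; _+_; _*_; _∸_; _<ᵇ_; _≡ᵇ_)
open import Data.Nat.Combinatorics using (_C_)
open import Data.Integer using (ℤ; +_; -[1+_])
open import Data.List using (List; []; _∷_; length; filterᵇ; concatMap; map; _++_; sum; upTo)
open import Data.Product using (_×_; _,_)

-- A two-row filling: (top row, bottom row), each listed left to right.
-- Entries are values 1..M where M = length μ.

allLists : ℕ → ℕ → List (List ℕ)
allLists M zero = [] ∷ []
allLists M (suc n) = concatMap (λ v → map (v ∷_) (allLists M n)) (map suc (upTo M))

strictInc : List ℕ → Bool
strictInc [] = true
strictInc (x ∷ []) = true
strictInc (x ∷ y ∷ xs) = (x <ᵇ y) ∧ strictInc (y ∷ xs)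

occ : ℕ → List ℕ → ℕ
occ v xs = length (filterᵇ (λ x → x ≡ᵇ v) xs)

contentFrom : ℕ → List ℕ → List ℕ → Bool
contentFrom v [] xs = true
contentFrom v (m ∷ ms) xs = (occ v xs ≡ᵇ m) ∧ contentFrom (suc v) ms xs

hasContent : List ℕ → List ℕ → Bool
hasContent μ xs = contentFrom 1 μ xs

-- Compare the entries to the right of the cell with the smaller entry (xs)
-- and of the cell with the larger entry (ys); 'below' says whether the
-- smaller entry's cell is in the bottom row.
walk : List ℕ → List ℕ → Bool → Bool
walk [] ys below = below
walk (x ∷ xs) [] below = below
walk (x ∷ xs) (y ∷ ys) below = if x ≡ᵇ y then walk xs ys below else (y <ᵇ x)

invCount : List ℕ → List ℕ → ℕ
invCount [] bs = 0
invCount (t ∷ ts) [] = 0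
invCount (t ∷ ts) (b ∷ bs) =
  (if t <ᵇ b then (if walk ts bs false then 1 else 0)
   else if b <ᵇ t then (if walk bs ts true then 1 else 0) else 0)
  + invCount ts bs

candidates : ℕ → ℕ → List ℕ → List (List ℕ × List ℕ)
candidates a b μ = concatMap (λ t → map (λ s → (t , s)) (allLists (length μ) b)) (allLists (length μ) a)

isInS : ℕ → List ℕ → List ℕ × List ℕ → Bool
isInS k μ (t , s) = strictInc t ∧ strictInc s ∧ hasContent μ (t ++ s) ∧ (invCount t s ≡ᵇ k)

cardS : ℕ → ℕ → ℕ → List ℕ → ℕ
cardS k a b μ = length (filterᵇ (isInS k μ) (candidates a b μ))

binomZ : ℕ → ℤ → ℕ
binomZ n (+ r) = n C r
binomZ n -[1+ r ] = 0

numTwos : List ℕ → ℕ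
numTwos μ = length (filterᵇ (λ x → x ≡ᵇ 2) μ)

-- Fillings are built by appending the values in decreasing order: the largest value X ends its
-- row or rows, and deleting it leaves a filling of the remaining content. As long as the bottom
-- row is no longer than the top row, appending X changes no inversion, except when a single X
-- turns the shape (p, p + 1), which is not a partition, into (p + 1, p + 1); exchanging the rows
-- of the former shows that this adds exactly one inversion. So a value occurring twice just
-- removes a column, while a value occurring once gives Pascal's recurrence for the ballot
-- numbers C(n, r) − C(n, r − 1) with n = a + b − 2m and r = b − m − k, whose closed form is
-- the stated formula.

module Submission where

open import Defs

open import Data.Bool using (Bool; true; false; _∧_; if_then_else_)
open import Data.Bool.Properties using (T-≡; ∧-assoc; ∧-identityʳ)
open import Data.Empty using (⊥)
open import Data.Integer using (_⊖_)
import Data.Integer as ℤ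
open import Data.Integer.Properties using (⊖-≥; ⊖-<; [+m]-[+n]≡m⊖n; +-cancelˡ-⊖)
open import Data.List using (List; []; _∷_; length; filterᵇ; map; _++_; reverse; concatMap; upTo)
open import Data.List.Properties
  using (length-++; length-reverse; filter-++; filter-none; unfold-reverse; reverse-involutive;
         ∷-injective; ∷ʳ-injectiveˡ)
open import Data.List.Membership.Propositional using (_∈_; lose; find)
open import Data.List.Membership.Propositional.Properties
  using (∈-map⁺; ∈-map⁻; ∈-++⁺ˡ; ∈-++⁺ʳ; ∈-filter⁺; ∈-filter⁻; ∈-concatMap⁺; ∈-concatMap⁻; ∈-upTo⁺; ∈-upTo⁻)
open import Data.List.Membership.Propositional.Properties.WithK using (unique∧set⇒bag)
open import Data.List.Relation.Binary.BagAndSetEquality using (∼bag⇒↭)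
open import Data.List.Relation.Binary.Disjoint.Propositional using (Disjoint)
open import Data.List.Relation.Binary.Permutation.Propositional.Properties using (↭-length)
open import Data.List.Relation.Unary.All as All using (All; []; _∷_)
import Data.List.Relation.Unary.All.Properties as All
open import Data.List.Relation.Unary.AllPairs as AllPairs using ([]; _∷_)
import Data.List.Relation.Unary.AllPairs.Properties as AllPairs
open import Data.List.Relation.Unary.Any using (here)
open import Data.List.Relation.Unary.Unique.Propositional using (Unique)
import Data.List.Relation.Unary.Unique.Propositional.Properties as Unique
open import Data.Nat using (ℕ; zero; suc; _+_; _*_; _∸_; _≤_; _<_; z≤n; s≤s; _<ᵇ_; _≡ᵇ_)
open import Data.Nat.Combinatorics using (_C_; nCk+nC[k+1]≡[n+1]C[k+1]; nCk≡nC[n∸k]; nC1≡n)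
open import Data.Nat.ListAction using (sum)
open import Data.Nat.Properties
open import Data.Nat.Tactic.RingSolver using (solve-∀)
open import Data.Product using (_×_; _,_; proj₁; proj₂; swap)
open import Data.Sum using (_⊎_; inj₁; inj₂)
open import Data.Unit using (⊤; tt)
open import Function using (_∘_)
open import Function.Bundles using (Equivalence; mk⇔)
open import Relation.Binary.PropositionalEquality
open import Relation.Nullary using (¬_; contradiction; yes; no)
open import Relation.Nullary.Decidable using (T?)

open Equivalence using (to; from)

private variable
  xs : List ℕ

<⇒<ᵇ≡true : ∀ {m n} → m < n → (m <ᵇ n) ≡ true
<⇒<ᵇ≡true = to T-≡ ∘ <⇒<ᵇ

<ᵇ≡true⇒< : ∀ {m n} → (m <ᵇ n) ≡ true → m < n
<ᵇ≡true⇒< {m} {n} = <ᵇ⇒< m n ∘ from T-≡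

≤⇒<ᵇ≡false : ∀ {n m} → n ≤ m → (m <ᵇ n) ≡ false
≤⇒<ᵇ≡false {n} {m} n≤m with m <ᵇ n in eq
... | false = refl
... | true  = contradiction (<ᵇ≡true⇒< eq) (≤⇒≯ n≤m)

≡⇒≡ᵇ≡true : ∀ {m n} → m ≡ n → (m ≡ᵇ n) ≡ true
≡⇒≡ᵇ≡true {m} {n} = to T-≡ ∘ ≡⇒≡ᵇ m n

≡ᵇ≡true⇒≡ : ∀ {m n} → (m ≡ᵇ n) ≡ true → m ≡ n
≡ᵇ≡true⇒≡ {m} {n} = ≡ᵇ⇒≡ m n ∘ from T-≡

≢⇒≡ᵇ≡false : ∀ {m n} → m ≢ n → (m ≡ᵇ n) ≡ false
≢⇒≡ᵇ≡false {m} {n} m≢n with m ≡ᵇ n in eq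
... | false = refl
... | true  = contradiction (≡ᵇ≡true⇒≡ eq) m≢n

∧≡true⁻ : ∀ {x y} → x ∧ y ≡ true → x ≡ true × y ≡ true
∧≡true⁻ {true} {true} _ = refl , refl

∧≡true⁺ : ∀ {x y} → x ≡ true → y ≡ true → x ∧ y ≡ true
∧≡true⁺ refl refl = refl

countᵇ : {A : Set} → (A → Bool) → List A → ℕ
countᵇ P []       = 0
countᵇ P (x ∷ xs) = (if P x then 1 else 0) + countᵇ P xs

module _ {A : Set} where

  length-filterᵇ : (P : A → Bool) (xs : List A) → length (filterᵇ P xs) ≡ countᵇ P xs
  length-filterᵇ P []       = refl
  length-filterᵇ P (x ∷ xs) with P x
  ... | true  = cong suc (length-filterᵇ P xs)
  ... | false = length-filterᵇ P xs

  countᵇ-++ : (P : A → Bool) (xs ys : List A) → countᵇ P (xs ++ ys) ≡ countᵇ P xs + countᵇ P ys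
  countᵇ-++ P []       ys = refl
  countᵇ-++ P (x ∷ xs) ys =
    trans (cong ((if P x then 1 else 0) +_) (countᵇ-++ P xs ys)) (sym (+-assoc (if P x then 1 else 0) _ _))

  countᵇ-map : {B : Set} (P : B → Bool) (f : A → B) (xs : List A) →
               countᵇ P (map f xs) ≡ countᵇ (P ∘ f) xs
  countᵇ-map P f []       = refl
  countᵇ-map P f (x ∷ xs) = cong ((if P (f x) then 1 else 0) +_) (countᵇ-map P f xs)

  countᵇ-cong : {P Q : A → Bool} {xs : List A} → All (λ x → P x ≡ Q x) xs → countᵇ P xs ≡ countᵇ Q xs
  countᵇ-cong []         = refl
  countᵇ-cong (eq ∷ eqs) = cong₂ (λ b n → (if b then 1 else 0) + n) eq (countᵇ-cong eqs)

  countᵇ-none : {P : A → Bool} {xs : List A} → All (λ x → P x ≡ false) xs → countᵇ P xs ≡ 0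
  countᵇ-none []         = refl
  countᵇ-none (eq ∷ eqs) rewrite eq = countᵇ-none eqs

  countᵇ≤length : (P : A → Bool) (xs : List A) → countᵇ P xs ≤ length xs
  countᵇ≤length P []       = z≤n
  countᵇ≤length P (x ∷ xs) with P x
  ... | true  = s≤s (countᵇ≤length P xs)
  ... | false = m≤n⇒m≤1+n (countᵇ≤length P xs)

  countᵇ-reverse : (P : A → Bool) (xs : List A) → countᵇ P (reverse xs) ≡ countᵇ P xs
  countᵇ-reverse P []       = refl
  countᵇ-reverse P (x ∷ xs) = begin
    countᵇ P (reverse (x ∷ xs))         ≡⟨ cong (countᵇ P) (unfold-reverse x xs) ⟩
    countᵇ P (reverse xs ++ x ∷ [])     ≡⟨ countᵇ-++ P (reverse xs) (x ∷ []) ⟩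
    countᵇ P (reverse xs) + (c + 0)     ≡⟨ cong₂ _+_ (countᵇ-reverse P xs) (+-identityʳ c) ⟩
    countᵇ P xs + c                     ≡⟨ +-comm (countᵇ P xs) c ⟩
    c + countᵇ P xs                     ∎
    where
    open ≡-Reasoning
    c = if P x then 1 else 0

  All-reverse : {P : A → Set} {xs : List A} → All P xs → All P (reverse xs)
  All-reverse []                               = []
  All-reverse {P} {x ∷ xs} (px ∷ pxs) =
    subst (All P) (sym (unfold-reverse x xs)) (All.++⁺ (All-reverse pxs) (px ∷ []))

occ-++ : ∀ v xs ys → occ v (xs ++ ys) ≡ occ v xs + occ v ys
occ-++ v xs ys = trans (cong length (filter-++ _ xs ys)) (length-++ (filterᵇ (_≡ᵇ v) xs))

occ-all< : ∀ {X} → All (_< X) xs → occ X xs ≡ 0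
occ-all< xs<X = cong length (filter-none _ (All.map (λ x<X → <⇒≢ x<X ∘ ≡ᵇ⇒≡ _ _) xs<X))

occ-snoc< : ∀ {X v} xs → v < X → occ v (xs ++ X ∷ []) ≡ occ v xs
occ-snoc< {X} {v} xs v<X
  rewrite occ-++ v xs (X ∷ []) | ≢⇒≡ᵇ≡false {X} {v} (≢-sym (<⇒≢ v<X)) = +-identityʳ (occ v xs)

occ-snoc-max : ∀ {X} xs → All (_< X) xs → occ X (xs ++ X ∷ []) ≡ 1
occ-snoc-max {X} xs xs<X
  rewrite occ-++ X xs (X ∷ []) | occ-all< xs<X | ≡⇒≡ᵇ≡true {X} {X} refl = refl

-- Inversions after appending the largest value

length-snoc : ∀ {X : ℕ} (xs : List ℕ) → length (xs ++ X ∷ []) ≡ suc (length xs)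
length-snoc xs = trans (length-++ xs) (+-comm (length xs) 1)

walk-[]ʳ : ∀ xs b → walk xs [] b ≡ b
walk-[]ʳ []      b = refl
walk-[]ʳ (_ ∷ _) b = refl

walk-snocˡ : ∀ xs ys b X → length ys ≤ length xs → walk (xs ++ X ∷ []) ys b ≡ walk xs ys b
walk-snocˡ []       []       b X _ = refl
walk-snocˡ (x ∷ xs) []       b X _ = refl
walk-snocˡ (x ∷ xs) (y ∷ ys) b X (s≤s le) with x ≡ᵇ y
... | true  = walk-snocˡ xs ys b X le
... | false = refl

walk-snocʳ : ∀ xs ys b X → length ys ≤ length xs → walk ys (xs ++ X ∷ []) b ≡ walk ys xs b
walk-snocʳ []       []       b X _ = refl
walk-snocʳ (x ∷ xs) []       b X _ = refl
walk-snocʳ (x ∷ xs) (y ∷ ys) b X (s≤s le) with y ≡ᵇ x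
... | true  = walk-snocʳ xs ys b X le
... | false = refl

walk-snoc-maxʳ : ∀ xs ys X → length ys < length xs → All (_< X) xs →
                 walk xs (ys ++ X ∷ []) false ≡ walk xs ys false
walk-snoc-maxʳ (x ∷ xs) [] X _ (x<X ∷ _)
  rewrite ≢⇒≡ᵇ≡false (<⇒≢ x<X) | ≤⇒<ᵇ≡false (<⇒≤ x<X) = refl
walk-snoc-maxʳ (x ∷ xs) (y ∷ ys) X (s≤s le) (_ ∷ xs<X) with x ≡ᵇ y
... | true  = walk-snoc-maxʳ xs ys X le xs<X
... | false = refl

walk-snoc-maxˡ : ∀ xs ys X → length ys < length xs → All (_< X) xs →
                 walk (ys ++ X ∷ []) xs true ≡ walk ys xs true
walk-snoc-maxˡ (x ∷ xs) [] X _ (x<X ∷ _)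
  rewrite ≢⇒≡ᵇ≡false (≢-sym (<⇒≢ x<X)) | <⇒<ᵇ≡true x<X = refl
walk-snoc-maxˡ (x ∷ xs) (y ∷ ys) X (s≤s le) (_ ∷ xs<X) with y ≡ᵇ x
... | true  = walk-snoc-maxˡ xs ys X le xs<X
... | false = refl

walk-snoc-snoc : ∀ xs ys b X → length xs ≡ length ys → walk (xs ++ X ∷ []) (ys ++ X ∷ []) b ≡ walk xs ys b
walk-snoc-snoc []       []       b X _ rewrite ≡⇒≡ᵇ≡true {X} refl = refl
walk-snoc-snoc (x ∷ xs) (y ∷ ys) b X eq with x ≡ᵇ y
... | true  = walk-snoc-snoc xs ys b X (suc-injective eq)
... | false = refl

walk-snoc-maxˡ-irrelevant : ∀ xs ys X b b′ → length ys ≡ suc (length xs) → All (_< X) ys →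
                            walk (xs ++ X ∷ []) ys b ≡ walk (xs ++ X ∷ []) ys b′
walk-snoc-maxˡ-irrelevant [] (y ∷ []) X b b′ _ (y<X ∷ _)
  rewrite ≢⇒≡ᵇ≡false (≢-sym (<⇒≢ y<X)) = refl
walk-snoc-maxˡ-irrelevant (x ∷ xs) (y ∷ ys) X b b′ eq (_ ∷ ys<X) with x ≡ᵇ y
... | true  = walk-snoc-maxˡ-irrelevant xs ys X b b′ (suc-injective eq) ys<X
... | false = refl

walk-snoc-maxʳ-irrelevant : ∀ xs ys X b b′ → length ys ≡ suc (length xs) → All (_< X) ys →
                            walk ys (xs ++ X ∷ []) b ≡ walk ys (xs ++ X ∷ []) b′
walk-snoc-maxʳ-irrelevant [] (y ∷ []) X b b′ _ (y<X ∷ _)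
  rewrite ≢⇒≡ᵇ≡false (<⇒≢ y<X) = refl
walk-snoc-maxʳ-irrelevant (x ∷ xs) (y ∷ ys) X b b′ eq (_ ∷ ys<X) with y ≡ᵇ x
... | true  = walk-snoc-maxʳ-irrelevant xs ys X b b′ (suc-injective eq) ys<X
... | false = refl

invCount-[]ʳ : ∀ t → invCount t [] ≡ 0
invCount-[]ʳ []      = refl
invCount-[]ʳ (_ ∷ _) = refl

invCount-snoc-top : ∀ t s X → length s ≤ length t → invCount (t ++ X ∷ []) s ≡ invCount t s
invCount-snoc-top []      []      X _ = refl
invCount-snoc-top (_ ∷ _) []      X _ = refl
invCount-snoc-top (_ ∷ t) (_ ∷ s) X (s≤s le)
  rewrite walk-snocˡ t s false X le | walk-snocʳ t s true X le | invCount-snoc-top t s X le = refl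

invCount-snoc-bottom : ∀ t s X → length s < length t → All (_< X) t → invCount t (s ++ X ∷ []) ≡ invCount t s
invCount-snoc-bottom (x ∷ t) [] X _ (x<X ∷ _)
  rewrite <⇒<ᵇ≡true x<X | walk-[]ʳ t false | invCount-[]ʳ t = refl
invCount-snoc-bottom (_ ∷ t) (_ ∷ s) X (s≤s le) (_ ∷ t<X)
  rewrite walk-snoc-maxʳ t s X le t<X | walk-snoc-maxˡ t s X le t<X | invCount-snoc-bottom t s X le t<X = refl

invCount-snoc-both : ∀ t s X → length s ≤ length t → All (_< X) t →
                     invCount (t ++ X ∷ []) (s ++ X ∷ []) ≡ invCount t s
invCount-snoc-both t s X s≤t t<X with m≤n⇒m<n∨m≡n s≤t
... | inj₁ s<t = trans (invCount-snoc-top t (s ++ X ∷ []) X (≤-trans (≤-reflexive (length-snoc {X} s)) s<t))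
                       (invCount-snoc-bottom t s X s<t t<X)
... | inj₂ s≡t = equal t s (sym s≡t)
  where
  equal : ∀ t s → length t ≡ length s → invCount (t ++ X ∷ []) (s ++ X ∷ []) ≡ invCount t s
  equal []      []      _  rewrite ≤⇒<ᵇ≡false {X} {X} ≤-refl = refl
  equal (_ ∷ t) (_ ∷ s) eq
    rewrite walk-snoc-snoc t s false X (suc-injective eq) | walk-snoc-snoc s t true X (sym (suc-injective eq))
          | equal t s (suc-injective eq) = refl

-- Every column but the last is decided before either row ends; in the last column X sits
-- above a smaller entry, which is an inversion exactly when X is in the top row.
invCount-snoc-top-swap : ∀ t s X → length s ≡ suc (length t) → All (_< X) s →
                         invCount (t ++ X ∷ []) s ≡ suc (invCount s (t ++ X ∷ []))
invCount-snoc-top-swap [] (y ∷ []) X _ (y<X ∷ _)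
  rewrite ≤⇒<ᵇ≡false (<⇒≤ y<X) | <⇒<ᵇ≡true y<X = refl
invCount-snoc-top-swap (x ∷ t) (y ∷ s) X eq (_ ∷ s<X) with x <ᵇ y in x<y | y <ᵇ x in y<x
... | true  | true  = contradiction (<ᵇ≡true⇒< {y} {x} y<x) (<⇒≯ (<ᵇ≡true⇒< {x} {y} x<y))
... | true  | false
  rewrite walk-snoc-maxˡ-irrelevant t s X false true (suc-injective eq) s<X =
  trans (cong (c +_) (invCount-snoc-top-swap t s X (suc-injective eq) s<X)) (+-suc c _)
  where c = if walk (t ++ X ∷ []) s true then 1 else 0
... | false | true
  rewrite walk-snoc-maxʳ-irrelevant t s X true false (suc-injective eq) s<X =
  trans (cong (c +_) (invCount-snoc-top-swap t s X (suc-injective eq) s<X)) (+-suc c _)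
  where c = if walk s (t ++ X ∷ []) false then 1 else 0
... | false | false = invCount-snoc-top-swap t s X (suc-injective eq) s<X

-- Fillings, built from the largest value down

OnesAndTwos : List ℕ → Set
OnesAndTwos = All (λ c → c ≡ 1 ⊎ c ≡ 2)

twos : List ℕ → ℕ
twos = countᵇ (_≡ᵇ 2)

Filling : Set
Filling = List ℕ × List ℕ

snocTop snocBottom snocBoth : ℕ → Filling → Filling
snocTop    X (t , s) = t ++ X ∷ [] , s
snocBottom X (t , s) = t , s ++ X ∷ []
snocBoth   X (t , s) = t ++ X ∷ [] , s ++ X ∷ []

atPred : {A : Set} → ℕ → (ℕ → List A) → List A
atPred zero    f = []
atPred (suc n) f = f n

-- fillings ν p q lists the fillings with rows of lengths p and q (q > p is allowed) and content
-- reverse ν: the head of ν is the multiplicity of the largest value length ν, which ends the rows.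
-- Only multiplicities 1 and 2 are handled; any other yields no fillings.
fillings : List ℕ → ℕ → ℕ → List Filling
fillings []      zero zero = ([] , []) ∷ []
fillings (1 ∷ ν) p    q    =
  map (snocTop (suc (length ν))) (atPred p (λ p′ → fillings ν p′ q)) ++
  map (snocBottom (suc (length ν))) (atPred q (fillings ν p))
fillings (2 ∷ ν) (suc p) (suc q) = map (snocBoth (suc (length ν))) (fillings ν p q)
fillings _ _ _ = []

countᵇ-atPred : ∀ {A B : Set} {P : A → Bool} {Q : B → Bool} {f g} n →
                (∀ m → countᵇ P (f m) ≡ countᵇ Q (g m)) → countᵇ P (atPred n f) ≡ countᵇ Q (atPred n g)
countᵇ-atPred zero    eq = refl
countᵇ-atPred (suc n) eq = eq n

fillings-swap : ∀ ν (P : Filling → Bool) p q → countᵇ P (fillings ν p q) ≡ countᵇ (P ∘ swap) (fillings ν q p)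
fillings-swap []               P zero    zero    = refl
fillings-swap []               P zero    (suc q) = refl
fillings-swap []               P (suc p) zero    = refl
fillings-swap []               P (suc p) (suc q) = refl
fillings-swap (zero ∷ ν)       P p       q       = refl
fillings-swap (1 ∷ ν)          P p       q       = begin
  countᵇ P (tops p q ++ bottoms p q)                     ≡⟨ countᵇ-++ P (tops p q) (bottoms p q) ⟩
  countᵇ P (tops p q) + countᵇ P (bottoms p q)           ≡⟨ cong₂ _+_ (top⇒bottom p q) (bottom⇒top p q) ⟩
  countᵇ P′ (bottoms q p) + countᵇ P′ (tops q p)         ≡⟨ +-comm (countᵇ P′ (bottoms q p)) _ ⟩
  countᵇ P′ (tops q p) + countᵇ P′ (bottoms q p)         ≡⟨ countᵇ-++ P′ (tops q p) (bottoms q p) ⟨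
  countᵇ P′ (tops q p ++ bottoms q p)                    ∎
  where
  open ≡-Reasoning
  X  = suc (length ν)
  P′ = P ∘ swap
  tops bottoms : ℕ → ℕ → List Filling
  tops    p q = map (snocTop X) (atPred p (λ p′ → fillings ν p′ q))
  bottoms p q = map (snocBottom X) (atPred q (fillings ν p))
  top⇒bottom : ∀ p q → countᵇ P (tops p q) ≡ countᵇ P′ (bottoms q p)
  top⇒bottom p q = trans (countᵇ-map P (snocTop X) (atPred p (λ p′ → fillings ν p′ q)))
    (trans (countᵇ-atPred {f = λ p′ → fillings ν p′ q} {g = fillings ν q} p
                          (λ p′ → fillings-swap ν (P ∘ snocTop X) p′ q))
           (sym (countᵇ-map P′ (snocBottom X) (atPred p (fillings ν q)))))
  bottom⇒top : ∀ p q → countᵇ P (bottoms p q) ≡ countᵇ P′ (tops q p)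
  bottom⇒top p q = trans (countᵇ-map P (snocBottom X) (atPred q (fillings ν p)))
    (trans (countᵇ-atPred {f = fillings ν p} {g = λ q′ → fillings ν q′ p} q
                          (λ q′ → fillings-swap ν (P ∘ snocBottom X) p q′))
           (sym (countᵇ-map P′ (snocTop X) (atPred q (λ q′ → fillings ν q′ p)))))
fillings-swap (2 ∷ ν)          P zero    zero    = refl
fillings-swap (2 ∷ ν)          P zero    (suc q) = refl
fillings-swap (2 ∷ ν)          P (suc p) zero    = refl
fillings-swap (2 ∷ ν)          P (suc p) (suc q) =
  trans (countᵇ-map P (snocBoth X) (fillings ν p q))
    (trans (fillings-swap ν (P ∘ snocBoth X) p q) (sym (countᵇ-map (P ∘ swap) (snocBoth X) (fillings ν q p))))
  where X = suc (length ν)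
fillings-swap (suc (suc (suc c)) ∷ ν) P p q = refl

strictInc-head : ∀ {x y} ys → strictInc (x ∷ y ∷ ys) ≡ true → x < y
strictInc-head {x} {y} ys inc = <ᵇ≡true⇒< {x} {y} (proj₁ (∧≡true⁻ inc))

strictInc-tail : ∀ x xs → strictInc (x ∷ xs) ≡ true → strictInc xs ≡ true
strictInc-tail x []      _   = refl
strictInc-tail x (y ∷ _) inc = proj₂ (∧≡true⁻ {x <ᵇ y} inc)

strictInc-snoc : ∀ {X} xs → strictInc xs ≡ true → All (_< X) xs → strictInc (xs ++ X ∷ []) ≡ true
strictInc-snoc []           _   _          = refl
strictInc-snoc (x ∷ [])     _   (x<X ∷ _)  = ∧≡true⁺ (<⇒<ᵇ≡true x<X) refl
strictInc-snoc (x ∷ y ∷ xs) inc (_ ∷ xs<X) =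
  ∧≡true⁺ (proj₁ (∧≡true⁻ inc)) (strictInc-snoc (y ∷ xs) (proj₂ (∧≡true⁻ {x <ᵇ y} inc)) xs<X)

strictInc-init : ∀ {X} xs → strictInc (xs ++ X ∷ []) ≡ true → strictInc xs ≡ true
strictInc-init []           _   = refl
strictInc-init (x ∷ [])     _   = refl
strictInc-init (x ∷ y ∷ xs) inc =
  ∧≡true⁺ (proj₁ (∧≡true⁻ inc)) (strictInc-init (y ∷ xs) (proj₂ (∧≡true⁻ {x <ᵇ y} inc)))

InRange : ℕ → List ℕ → Set
InRange M = All (λ v → 1 ≤ v × v ≤ M)

InRange⇒< : ∀ {M} → InRange M xs → All (_< suc M) xs
InRange⇒< = All.map (s≤s ∘ proj₂)

InRange-weaken : ∀ {M} → InRange M xs → InRange (suc M) xs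
InRange-weaken = All.map (λ (1≤v , v≤M) → 1≤v , m≤n⇒m≤1+n v≤M)

InRange-strengthen : ∀ {M} → All (_< suc M) xs → InRange (suc M) xs → InRange M xs
InRange-strengthen []           []                 = []
InRange-strengthen (v<M ∷ xs<M) ((1≤v , _) ∷ rng) = (1≤v , ≤-pred v<M) ∷ InRange-strengthen xs<M rng

record IsRow (M : ℕ) (xs : List ℕ) : Set where
  constructor row
  field
    inRange    : InRange M xs
    increasing : strictInc xs ≡ true
open IsRow

IsRow⇒< : ∀ {M} → IsRow M xs → All (_< suc M) xs
IsRow⇒< = InRange⇒< ∘ inRange

IsRow-weaken : ∀ {M} → IsRow M xs → IsRow (suc M) xs
IsRow-weaken (row rng inc) = row (InRange-weaken rng) inc

IsRow-snoc : ∀ {M} → IsRow M xs → IsRow (suc M) (xs ++ suc M ∷ [])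
IsRow-snoc {xs} (row rng inc) =
  row (All.++⁺ (InRange-weaken rng) ((s≤s z≤n , ≤-refl) ∷ [])) (strictInc-snoc xs inc (InRange⇒< rng))

IsRow-strengthen : ∀ {M} → All (_< suc M) xs → IsRow (suc M) xs → IsRow M xs
IsRow-strengthen xs<M (row rng inc) = row (InRange-strengthen xs<M rng) inc

IsRow-init : ∀ {M} → All (_< suc M) xs → IsRow (suc M) (xs ++ suc M ∷ []) → IsRow M xs
IsRow-init {xs} xs<M (row rng inc) =
  row (InRange-strengthen xs<M (All.++⁻ˡ xs rng)) (strictInc-init xs inc)

occ₂ : ℕ → Filling → ℕ
occ₂ v (t , s) = occ v t + occ v s

HasContent : List ℕ → Filling → Set
HasContent []      x = ⊤
HasContent (c ∷ ν) x = occ₂ (suc (length ν)) x ≡ c × HasContent ν x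

HasContent-cong : ∀ ν {x y} → (∀ i → i < length ν → occ₂ (suc i) x ≡ occ₂ (suc i) y) →
                  HasContent ν x → HasContent ν y
HasContent-cong []      eq tt         = tt
HasContent-cong (c ∷ ν) eq (occ≡ , h) =
  trans (sym (eq (length ν) ≤-refl)) occ≡ , HasContent-cong ν (λ i i<ν → eq i (m≤n⇒m≤1+n i<ν)) h

module _ {X v : ℕ} (v<X : v < X) where

  occ₂-snocTop< : ∀ x → occ₂ v (snocTop X x) ≡ occ₂ v x
  occ₂-snocTop< (t , s) = cong (_+ occ v s) (occ-snoc< t v<X)

  occ₂-snocBottom< : ∀ x → occ₂ v (snocBottom X x) ≡ occ₂ v x
  occ₂-snocBottom< (t , s) = cong (occ v t +_) (occ-snoc< s v<X)

  occ₂-snocBoth< : ∀ x → occ₂ v (snocBoth X x) ≡ occ₂ v x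
  occ₂-snocBoth< (t , s) = cong₂ _+_ (occ-snoc< t v<X) (occ-snoc< s v<X)

record IsFilling (ν : List ℕ) (p q : ℕ) (x : Filling) : Set where
  constructor filling
  field
    top-length    : length (proj₁ x) ≡ p
    bottom-length : length (proj₂ x) ≡ q
    top-row       : IsRow (length ν) (proj₁ x)
    bottom-row    : IsRow (length ν) (proj₂ x)
    content       : HasContent ν x

module _ {ν : List ℕ} {t s : List ℕ} where
  private
    X = suc (length ν)

  IsFilling-snocTop : ∀ {p q} → IsFilling ν p q (t , s) → IsFilling (1 ∷ ν) (suc p) q (snocTop X (t , s))
  IsFilling-snocTop (filling lt ls rt rs ct) =
    filling (trans (length-snoc t) (cong suc lt)) ls (IsRow-snoc rt) (IsRow-weaken rs)
      (cong₂ _+_ (occ-snoc-max t (IsRow⇒< rt)) (occ-all< (IsRow⇒< rs)) ,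
       HasContent-cong ν (λ i i<ν → sym (occ₂-snocTop< (s≤s i<ν) (t , s))) ct)

  IsFilling-snocBottom : ∀ {p q} → IsFilling ν p q (t , s) → IsFilling (1 ∷ ν) p (suc q) (snocBottom X (t , s))
  IsFilling-snocBottom (filling lt ls rt rs ct) =
    filling lt (trans (length-snoc s) (cong suc ls)) (IsRow-weaken rt) (IsRow-snoc rs)
      (cong₂ _+_ (occ-all< (IsRow⇒< rt)) (occ-snoc-max s (IsRow⇒< rs)) ,
       HasContent-cong ν (λ i i<ν → sym (occ₂-snocBottom< (s≤s i<ν) (t , s))) ct)

  IsFilling-snocBoth : ∀ {p q} → IsFilling ν p q (t , s) → IsFilling (2 ∷ ν) (suc p) (suc q) (snocBoth X (t , s))
  IsFilling-snocBoth (filling lt ls rt rs ct) =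
    filling (trans (length-snoc t) (cong suc lt)) (trans (length-snoc s) (cong suc ls)) (IsRow-snoc rt) (IsRow-snoc rs)
      (cong₂ _+_ (occ-snoc-max t (IsRow⇒< rt)) (occ-snoc-max s (IsRow⇒< rs)) ,
       HasContent-cong ν (λ i i<ν → sym (occ₂-snocBoth< (s≤s i<ν) (t , s))) ct)

  module _ {c p q : ℕ} (t<X : All (_< X) t) (s<X : All (_< X) s) where

    IsFilling-unsnocTop : IsFilling (c ∷ ν) p q (snocTop X (t , s)) → IsFilling ν (length t) (length s) (t , s)
    IsFilling-unsnocTop (filling _ _ rt rs (_ , ct)) =
      filling refl refl (IsRow-init t<X rt) (IsRow-strengthen s<X rs)
        (HasContent-cong ν (λ i i<ν → occ₂-snocTop< (s≤s i<ν) (t , s)) ct)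

    IsFilling-unsnocBottom : IsFilling (c ∷ ν) p q (snocBottom X (t , s)) → IsFilling ν (length t) (length s) (t , s)
    IsFilling-unsnocBottom (filling _ _ rt rs (_ , ct)) =
      filling refl refl (IsRow-strengthen t<X rt) (IsRow-init s<X rs)
        (HasContent-cong ν (λ i i<ν → occ₂-snocBottom< (s≤s i<ν) (t , s)) ct)

    IsFilling-unsnocBoth : IsFilling (c ∷ ν) p q (snocBoth X (t , s)) → IsFilling ν (length t) (length s) (t , s)
    IsFilling-unsnocBoth (filling _ _ rt rs (_ , ct)) =
      filling refl refl (IsRow-init t<X rt) (IsRow-init s<X rs)
        (HasContent-cong ν (λ i i<ν → occ₂-snocBoth< (s≤s i<ν) (t , s)) ct)

fillings-sound : ∀ ν p q → All (IsFilling ν p q) (fillings ν p q)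
fillings-sound []      zero    zero    = filling refl refl (row [] refl) (row [] refl) tt ∷ []
fillings-sound []      zero    (suc q) = []
fillings-sound []      (suc p) q       = []
fillings-sound (zero ∷ ν) p q = []
fillings-sound (1 ∷ ν) p q = All.++⁺ (All.map⁺ (tops p)) (All.map⁺ (bottoms q))
  where
  tops : ∀ p → All (IsFilling (1 ∷ ν) p q ∘ snocTop (suc (length ν))) (atPred p (λ p′ → fillings ν p′ q))
  tops zero    = []
  tops (suc p) = All.map IsFilling-snocTop (fillings-sound ν p q)
  bottoms : ∀ q → All (IsFilling (1 ∷ ν) p q ∘ snocBottom (suc (length ν))) (atPred q (fillings ν p))
  bottoms zero    = []
  bottoms (suc q) = All.map IsFilling-snocBottom (fillings-sound ν p q)
fillings-sound (2 ∷ ν) zero    q       = []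
fillings-sound (2 ∷ ν) (suc p) zero    = []
fillings-sound (2 ∷ ν) (suc p) (suc q) = All.map⁺ (All.map IsFilling-snocBoth (fillings-sound ν p q))
fillings-sound (suc (suc (suc c)) ∷ ν) p q = []

data MaxView (X : ℕ) : List ℕ → Set where
  all<    : ∀ {xs} → All (_< X) xs → MaxView X xs
  snocMax : ∀ {xs} → All (_< X) xs → MaxView X (xs ++ X ∷ [])

maxView : ∀ {X} xs → strictInc xs ≡ true → All (_≤ X) xs → MaxView X xs
maxView []       _   _ = all< []
maxView {X} (x ∷ xs) inc (x≤X ∷ xs≤X) with maxView xs (strictInc-tail x xs inc) xs≤X
... | snocMax ys<X = snocMax (x<X _ inc ys<X ∷ ys<X)
  where
  x<X : ∀ ys → strictInc (x ∷ ys ++ X ∷ []) ≡ true → All (_< X) ys → x < X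
  x<X []       inc _         = strictInc-head [] inc
  x<X (y ∷ ys) inc (y<X ∷ _) = <-trans (strictInc-head (ys ++ X ∷ []) inc) y<X
... | all< xs<X = cons xs inc xs<X
  where
  cons : ∀ xs → strictInc (x ∷ xs) ≡ true → All (_< X) xs → MaxView X (x ∷ xs)
  cons []       _   [] with m≤n⇒m<n∨m≡n x≤X
  ... | inj₁ x<X = all< (x<X ∷ [])
  ... | inj₂ refl = snocMax []
  cons (y ∷ ys) inc (y<X ∷ ys<X) = all< (<-trans (strictInc-head ys inc) y<X ∷ y<X ∷ ys<X)

module _ {ν p q x} (x∈ : x ∈ fillings ν p q) where

  ∈-fillings-snocTop : snocTop (suc (length ν)) x ∈ fillings (1 ∷ ν) (suc p) q
  ∈-fillings-snocTop = ∈-++⁺ˡ (∈-map⁺ _ x∈)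

  ∈-fillings-snocBottom : snocBottom (suc (length ν)) x ∈ fillings (1 ∷ ν) p (suc q)
  ∈-fillings-snocBottom = ∈-++⁺ʳ (map _ (atPred p (λ p′ → fillings ν p′ (suc q)))) (∈-map⁺ _ x∈)

  ∈-fillings-snocBoth : snocBoth (suc (length ν)) x ∈ fillings (2 ∷ ν) (suc p) (suc q)
  ∈-fillings-snocBoth = ∈-map⁺ _ x∈

fillings-complete : ∀ ν → OnesAndTwos ν → ∀ {p q x} → IsFilling ν p q x → x ∈ fillings ν p q
fillings-complete [] [] {x = [] , []} (filling refl refl _ _ _) = here refl
fillings-complete [] [] {x = _ ∷ _ , _} (filling _ _ (row ((0<v , v≤0) ∷ _) _) _ _) =
  contradiction v≤0 (<⇒≱ 0<v)
fillings-complete [] [] {x = [] , _ ∷ _} (filling _ _ _ (row ((0<v , v≤0) ∷ _) _) _) =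
  contradiction v≤0 (<⇒≱ 0<v)
fillings-complete (c ∷ ν) (c∈12 ∷ ν12) {x = t , s} f@(filling refl refl rt rs (occX , _))
  with maxView t (increasing rt) (All.map proj₂ (inRange rt))
     | maxView s (increasing rs) (All.map proj₂ (inRange rs)) | c∈12
... | all< t<X | all< s<X | inj₁ refl =
  contradiction (trans (sym occX) (cong₂ _+_ (occ-all< t<X) (occ-all< s<X))) λ ()
... | all< t<X | all< s<X | inj₂ refl =
  contradiction (trans (sym occX) (cong₂ _+_ (occ-all< t<X) (occ-all< s<X))) λ ()
... | snocMax {t′} t′<X | all< s<X | inj₁ refl =
  subst (λ p → snocTop X (t′ , s) ∈ fillings (1 ∷ ν) p (length s)) (sym (length-snoc t′))
    (∈-fillings-snocTop {ν} (fillings-complete ν ν12 (IsFilling-unsnocTop t′<X s<X f)))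
  where X = suc (length ν)
... | snocMax {t′} t′<X | all< s<X | inj₂ refl =
  contradiction (trans (sym occX) (cong₂ _+_ (occ-snoc-max t′ t′<X) (occ-all< s<X))) λ ()
... | all< t<X | snocMax {s′} s′<X | inj₁ refl =
  subst (λ q → snocBottom X (t , s′) ∈ fillings (1 ∷ ν) (length t) q) (sym (length-snoc s′))
    (∈-fillings-snocBottom {ν} (fillings-complete ν ν12 (IsFilling-unsnocBottom t<X s′<X f)))
  where X = suc (length ν)
... | all< t<X | snocMax {s′} s′<X | inj₂ refl =
  contradiction (trans (sym occX) (cong₂ _+_ (occ-all< t<X) (occ-snoc-max s′ s′<X))) λ ()
... | snocMax {t′} t′<X | snocMax {s′} s′<X | inj₁ refl =
  contradiction (trans (sym occX) (cong₂ _+_ (occ-snoc-max t′ t′<X) (occ-snoc-max s′ s′<X))) λ ()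
... | snocMax {t′} t′<X | snocMax {s′} s′<X | inj₂ refl =
  subst₂ (λ p q → snocBoth X (t′ , s′) ∈ fillings (2 ∷ ν) p q) (sym (length-snoc t′)) (sym (length-snoc s′))
    (∈-fillings-snocBoth {ν} (fillings-complete ν ν12 (IsFilling-unsnocBoth t′<X s′<X f)))
  where X = suc (length ν)

atPred-unique : ∀ {A : Set} {f : ℕ → List A} n → (∀ m → Unique (f m)) → Unique (atPred n f)
atPred-unique zero    _ = []
atPred-unique (suc n) u = u n

fillings-unique : ∀ ν p q → Unique (fillings ν p q)
fillings-unique []      zero    zero    = [] ∷ []
fillings-unique []      zero    (suc q) = []
fillings-unique []      (suc p) q       = []
fillings-unique (zero ∷ ν) p q = []
fillings-unique (1 ∷ ν) p q =
  Unique.++⁺ (Unique.map⁺ top-injective (atPred-unique p (λ p′ → fillings-unique ν p′ q)))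
             (Unique.map⁺ bottom-injective (atPred-unique q (fillings-unique ν p)))
             disjoint
  where
  X = suc (length ν)
  top-injective : ∀ {x y} → snocTop X x ≡ snocTop X y → x ≡ y
  top-injective {t , s} {t′ , s′} eq = cong₂ _,_ (∷ʳ-injectiveˡ t t′ (cong proj₁ eq)) (cong proj₂ eq)
  bottom-injective : ∀ {x y} → snocBottom X x ≡ snocBottom X y → x ≡ y
  bottom-injective {t , s} {t′ , s′} eq = cong₂ _,_ (cong proj₁ eq) (∷ʳ-injectiveˡ s s′ (cong proj₂ eq))
  tops<X : ∀ q → All (All (_< X) ∘ proj₁) (atPred q (fillings ν p))
  tops<X zero    = []
  tops<X (suc q) = All.map (IsRow⇒< ∘ IsFilling.top-row) (fillings-sound ν p q)
  disjoint : ∀ {x} → ¬ (x ∈ map (snocTop X) (atPred p (λ p′ → fillings ν p′ q)) ×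
                         x ∈ map (snocBottom X) (atPred q (fillings ν p)))
  disjoint (x∈tops , x∈bottoms) with ∈-map⁻ (snocTop X) x∈tops | ∈-map⁻ (snocBottom X) x∈bottoms
  ... | (t , _) , _ , refl | _ , y∈ , eq =
    <-irrefl refl (All.lookup (All.++⁻ʳ t X∈t<X) (here refl))
    where X∈t<X = subst (All (_< X)) (sym (cong proj₁ eq)) (All.lookup (tops<X q) y∈)
fillings-unique (2 ∷ ν) zero    q       = []
fillings-unique (2 ∷ ν) (suc p) zero    = []
fillings-unique (2 ∷ ν) (suc p) (suc q) = Unique.map⁺ both-injective (fillings-unique ν p q)
  where
  both-injective : ∀ {x y} → snocBoth (suc (length ν)) x ≡ snocBoth (suc (length ν)) y → x ≡ y
  both-injective {t , s} {t′ , s′} eq = cong₂ _,_ (∷ʳ-injectiveˡ t t′ (cong proj₁ eq)) (∷ʳ-injectiveˡ s s′ (cong proj₂ eq))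
fillings-unique (suc (suc (suc c)) ∷ ν) p q = []

fillings-short : ∀ ν {p q} → q < twos ν → fillings ν p q ≡ []
atPred-fillings-short : ∀ ν {p q} → q ≤ twos ν → atPred q (fillings ν p) ≡ []

fillings-short [] ()
fillings-short (zero ∷ ν) _ = refl
fillings-short (1 ∷ ν) {p} {q} q<m =
  cong₂ (λ l r → map (snocTop _) l ++ map (snocBottom _) r) (tops p) (atPred-fillings-short ν (<⇒≤ q<m))
  where
  tops : ∀ p → atPred p (λ p′ → fillings ν p′ q) ≡ []
  tops zero    = refl
  tops (suc p) = fillings-short ν q<m
fillings-short (2 ∷ ν) {zero}          _         = refl
fillings-short (2 ∷ ν) {suc p} {zero}  _         = refl
fillings-short (2 ∷ ν) {suc p} {suc q} (s≤s q<m) = cong (map _) (fillings-short ν q<m)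
fillings-short (suc (suc (suc c)) ∷ ν) _ = refl

atPred-fillings-short ν {q = zero}  _   = refl
atPred-fillings-short ν {q = suc q} q<m = fillings-short ν q<m

-- Counting fillings by inversions

hasInv : ℕ → Filling → Bool
hasInv k (t , s) = invCount t s ≡ᵇ k

hasSucInv : ℕ → Filling → Bool
hasSucInv k (t , s) = suc (invCount t s) ≡ᵇ k

countS : List ℕ → ℕ → ℕ → ℕ → ℕ
countS ν p q k = countᵇ (hasInv k) (fillings ν p q)

countᵇ-map-fillings : ∀ {ν p q} {P Q : Filling → Bool} (f : Filling → Filling) →
                      (∀ {x} → IsFilling ν p q x → P (f x) ≡ Q x) →
                      countᵇ P (map f (fillings ν p q)) ≡ countᵇ Q (fillings ν p q)
countᵇ-map-fillings {ν} {p} {q} {P} f P∘f≡Q =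
  trans (countᵇ-map P f (fillings ν p q)) (countᵇ-cong (All.map P∘f≡Q (fillings-sound ν p q)))

module _ (ν : List ℕ) (k : ℕ) where
  private
    X = suc (length ν)

  countS-1-below-diagonal : ∀ {p q} → q ≤ p →
    countS (1 ∷ ν) (suc p) q k ≡ countS ν p q k + countᵇ (hasInv k) (atPred q (fillings ν (suc p)))
  countS-1-below-diagonal {p} {q} q≤p =
    trans (countᵇ-++ (hasInv k) (map (snocTop X) (fillings ν p q)) _) (cong₂ _+_ top (bottom q q≤p))
    where
    top : countᵇ (hasInv k) (map (snocTop X) (fillings ν p q)) ≡ countS ν p q k
    top = countᵇ-map-fillings {ν} {P = hasInv k} (snocTop X) λ { {t , s} (filling lt ls _ _ _) →
      cong (_≡ᵇ k) (invCount-snoc-top t s X (subst₂ _≤_ (sym ls) (sym lt) q≤p)) }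
    bottom : ∀ q → q ≤ p → countᵇ (hasInv k) (map (snocBottom X) (atPred q (fillings ν (suc p))))
                           ≡ countᵇ (hasInv k) (atPred q (fillings ν (suc p)))
    bottom zero    _   = refl
    bottom (suc q) q<p = countᵇ-map-fillings {ν} {P = hasInv k} (snocBottom X) λ { {t , s} (filling lt ls rt _ _) →
      cong (_≡ᵇ k) (invCount-snoc-bottom t s X (subst₂ _<_ (sym ls) (sym lt) (s≤s (<⇒≤ q<p))) (IsRow⇒< rt)) }

  countS-1-diagonal : ∀ p →
    countS (1 ∷ ν) (suc p) (suc p) k ≡ countᵇ (hasSucInv k) (fillings ν (suc p) p) + countS ν (suc p) p k
  countS-1-diagonal p =
    trans (countᵇ-++ (hasInv k) (map (snocTop X) (fillings ν p (suc p))) _) (cong₂ _+_ top bottom)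
    where
    top : countᵇ (hasInv k) (map (snocTop X) (fillings ν p (suc p))) ≡ countᵇ (hasSucInv k) (fillings ν (suc p) p)
    top = trans
      (countᵇ-map-fillings {ν} {P = hasInv k} {Q = hasSucInv k ∘ swap} (snocTop X) λ { {t , s} (filling lt ls _ rs _) →
        cong (_≡ᵇ k) (trans (invCount-snoc-top-swap t s X (trans ls (cong suc (sym lt))) (IsRow⇒< rs))
                            (cong suc (invCount-snoc-bottom s t X (subst₂ _<_ (sym lt) (sym ls) ≤-refl) (IsRow⇒< rs)))) })
      (fillings-swap ν (hasSucInv k ∘ swap) p (suc p))
    bottom : countᵇ (hasInv k) (map (snocBottom X) (fillings ν (suc p) p)) ≡ countS ν (suc p) p k
    bottom = countᵇ-map-fillings {ν} {P = hasInv k} (snocBottom X) λ { {t , s} (filling lt ls rt _ _) →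
      cong (_≡ᵇ k) (invCount-snoc-bottom t s X (subst₂ _<_ (sym ls) (sym lt) ≤-refl) (IsRow⇒< rt)) }

  countS-2 : ∀ {p q} → q ≤ p → countS (2 ∷ ν) (suc p) (suc q) k ≡ countS ν p q k
  countS-2 q≤p = countᵇ-map-fillings {ν} {P = hasInv k} (snocBoth X) λ { {t , s} (filling lt ls rt _ _) →
    cong (_≡ᵇ k) (invCount-snoc-both t s X (subst₂ _≤_ (sym ls) (sym lt) q≤p) (IsRow⇒< rt)) }

-- Ballot numbers

C-pascal : ∀ n r → suc n C suc r ≡ n C r + n C suc r
C-pascal n r = sym (nCk+nC[k+1]≡[n+1]C[k+1] n r)

C-absorb : ∀ n r → suc r * (suc n C suc r) ≡ suc n * (n C r)
C-absorb zero    zero    = refl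
C-absorb zero    (suc r) = *-zeroʳ (suc (suc r))
C-absorb (suc n) zero    rewrite nC1≡n (suc (suc n)) = trans (+-identityʳ _) (sym (*-identityʳ (suc (suc n))))
C-absorb (suc n) (suc r) = begin
  suc (suc r) * (suc (suc n) C suc (suc r))   ≡⟨ cong (suc (suc r) *_) (C-pascal (suc n) (suc r)) ⟩
  suc (suc r) * (x + y)                        ≡⟨ split (suc r) x y ⟩
  x + suc r * x + suc (suc r) * y              ≡⟨ cong₂ (λ u v → x + u + v) (C-absorb n r) (C-absorb n (suc r)) ⟩
  x + suc n * (n C r) + suc n * (n C suc r)    ≡⟨ merge x (suc n) (n C r) (n C suc r) ⟩
  x + suc n * (n C r + n C suc r)              ≡⟨ cong (λ z → x + suc n * z) (C-pascal n r) ⟨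
  suc (suc n) * x                              ∎
  where
  open ≡-Reasoning
  x = suc n C suc r
  y = suc n C suc (suc r)
  split : ∀ r x y → suc r * (x + y) ≡ x + r * x + suc r * y
  split = solve-∀
  merge : ∀ x a u v → x + a * u + a * v ≡ x + a * (u + v)
  merge = solve-∀

-- n C (r − 1), read as 0 at r = 0
binomPrev : ℕ → ℕ → ℕ
binomPrev n zero    = 0
binomPrev n (suc r) = n C r

binomPrev-pascal : ∀ n r → suc n C r ≡ binomPrev n r + n C r
binomPrev-pascal n zero    = refl
binomPrev-pascal n (suc r) = C-pascal n r

C-absorb-prev : ∀ n r → r * (suc n C r) ≡ suc n * binomPrev n r
C-absorb-prev n zero    = sym (*-zeroʳ (suc n))
C-absorb-prev n (suc r) = C-absorb n r

C-absorb-shift : ∀ r e → ((r + suc e) C r) * suc e ≡ ((r + suc e) C suc r) * suc r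
C-absorb-shift r e = +-cancelˡ-≡ (r * x) _ _ (begin
  r * x + x * suc e                         ≡⟨ cong (r * x +_) (*-comm x (suc e)) ⟩
  r * x + suc e * x                         ≡⟨ *-distribʳ-+ x r (suc e) ⟨
  (r + suc e) * x                           ≡⟨ cong (λ N → N * (N C r)) (+-suc r e) ⟩
  suc n * (suc n C r)                       ≡⟨ cong (suc n *_) (binomPrev-pascal n r) ⟩
  suc n * (binomPrev n r + n C r)           ≡⟨ *-distribˡ-+ (suc n) (binomPrev n r) (n C r) ⟩
  suc n * binomPrev n r + suc n * (n C r)   ≡⟨ cong₂ _+_ (C-absorb-prev n r) (C-absorb n r) ⟨
  r * (suc n C r) + suc r * (suc n C suc r) ≡⟨ cong (λ N → r * (N C r) + suc r * (N C suc r)) (+-suc r e) ⟨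
  r * x + suc r * ((r + suc e) C suc r)     ≡⟨ cong (r * x +_) (*-comm (suc r) _) ⟩
  r * x + ((r + suc e) C suc r) * suc r     ∎)
  where
  open ≡-Reasoning
  n = r + e
  x = (r + suc e) C r

Ballot : ℕ → ℕ → ℕ → Set
Ballot n r c = c + binomPrev n r ≡ n C r

Ballot-pascal : ∀ {n r c₁ c₂} → Ballot n (suc r) c₁ → Ballot n r c₂ → Ballot (suc n) (suc r) (c₁ + c₂)
Ballot-pascal {n} {r} {c₁} {c₂} b₁ b₂ = begin
  c₁ + c₂ + suc n C r                   ≡⟨ cong (c₁ + c₂ +_) (binomPrev-pascal n r) ⟩
  c₁ + c₂ + (binomPrev n r + n C r)     ≡⟨ regroup c₁ c₂ (binomPrev n r) (n C r) ⟩
  (c₁ + n C r) + (c₂ + binomPrev n r)   ≡⟨ cong₂ _+_ b₁ b₂ ⟩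
  n C suc r + n C r                     ≡⟨ +-comm (n C suc r) (n C r) ⟩
  n C r + n C suc r                     ≡⟨ C-pascal n r ⟨
  suc n C suc r                         ∎
  where
  open ≡-Reasoning
  regroup : ∀ a b c d → a + b + (c + d) ≡ (a + d) + (b + c)
  regroup = solve-∀

Ballot-middle : ∀ n → Ballot (suc (n + n)) (suc n) 0
Ballot-middle n = trans (nCk≡nC[n∸k] (≤-trans (m≤m+n n n) (n≤1+n (n + n)))) (cong (suc (n + n) C_) middle)
  where
  middle : suc (n + n) ∸ n ≡ suc n
  middle = trans (cong (_∸ n) (sym (+-suc n n))) (m+n∸m≡n n (suc n))

Ballot-closed : ∀ r d {c} → Ballot (r + r + d) r c → c * suc (r + d) ≡ suc d * ((r + r + d) C r)
Ballot-closed zero    d {c} b = trans (cong (_* suc d) (trans (sym (+-identityʳ c)) b)) (*-comm 1 (suc d))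
Ballot-closed (suc r) d {c} b = +-cancelʳ-≡ (y * suc r) _ _ (begin
  c * suc e + y * suc r             ≡⟨ cong (c * suc e +_) absorb ⟨
  c * suc e + x * suc e             ≡⟨ *-distribʳ-+ (suc e) c x ⟨
  (c + x) * suc e                   ≡⟨ cong (_* suc e) b ⟩
  y * suc e                         ≡⟨ cong (λ z → y * suc z) (+-comm (suc r) d) ⟩
  y * (suc d + suc r)               ≡⟨ *-distribˡ-+ y (suc d) (suc r) ⟩
  y * suc d + y * suc r             ≡⟨ cong (_+ y * suc r) (*-comm y (suc d)) ⟩
  suc d * y + y * suc r             ∎)
  where
  open ≡-Reasoning
  e = suc r + d
  n = suc r + suc r + d
  x = n C r
  y = n C suc r
  n≡ : ∀ r d → suc r + suc r + d ≡ r + suc (suc r + d)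
  n≡ = solve-∀
  absorb : x * suc e ≡ y * suc r
  absorb = subst (λ N → (N C r) * suc e ≡ (N C suc r) * suc r) (sym (n≡ r d)) (C-absorb-shift r e)

-- c = n C (B − k) − n C (B − k − 1) if k ≤ B, and c = 0 if B < k
IsBallot : ℕ → ℕ → ℕ → ℕ → Set
IsBallot n B       zero    c = Ballot n B c
IsBallot n zero    (suc k) c = c ≡ 0
IsBallot n (suc B) (suc k) c = IsBallot n B k c

IsBallot-pascal : ∀ {n} B k {c₁ c₂} → IsBallot n B k c₁ → IsBallot n B (suc k) c₂ → IsBallot (suc n) B k (c₁ + c₂)
IsBallot-pascal zero    zero    b₁ refl = cong (_+ 0) b₁
IsBallot-pascal {n} (suc B) zero b₁ b₂ = Ballot-pascal {n} {B} b₁ b₂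
IsBallot-pascal zero    (suc k) refl refl = refl
IsBallot-pascal (suc B) (suc k) b₁ b₂   = IsBallot-pascal B k b₁ b₂

IsBallot-above : ∀ k {n r c} → IsBallot n (k + r) k c → Ballot n r c
IsBallot-above zero    b = b
IsBallot-above (suc k) b = IsBallot-above k b

IsBallot-below : ∀ B k {n c} → B < k → IsBallot n B k c → c ≡ 0
IsBallot-below zero    (suc k) _         b = b
IsBallot-below (suc B) (suc k) (s≤s B<k) b = IsBallot-below B k B<k b

BallotCounts : List ℕ → Set
BallotCounts ν = ∀ A B k → B ≤ A → A + B + twos ν ≡ length ν →
                 IsBallot (A + B) B k (countS ν (twos ν + A) (twos ν + B) k)

ballotCounts-[] : BallotCounts []
ballotCounts-[] zero    zero    zero    _  _ = refl
ballotCounts-[] zero    zero    (suc k) _  _ = refl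
ballotCounts-[] (suc A) B       k       _  ()

ballotCounts-2∷ : ∀ {ν} → BallotCounts ν → BallotCounts (2 ∷ ν)
ballotCounts-2∷ {ν} ih A B k B≤A len =
  subst (IsBallot (A + B) B k) (sym (countS-2 ν k (+-monoʳ-≤ (twos ν) B≤A)))
    (ih A B k B≤A (suc-injective (trans (sym (+-suc (A + B) (twos ν))) len)))

module _ {ν : List ℕ} (ih : BallotCounts ν) where
  private
    m = twos ν

  ballotCounts-1∷-below-diagonal : ∀ A B k → B ≤ A → suc A + B + m ≡ suc (length ν) →
    IsBallot (suc A + B) B k (countS (1 ∷ ν) (m + suc A) (m + B) k)
  ballotCounts-1∷-below-diagonal A B k B≤A len
    rewrite +-suc m A | countS-1-below-diagonal ν k (+-monoʳ-≤ m B≤A) =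
    IsBallot-pascal B k (ih A B k B≤A (suc-injective len)) (bottom B B≤A len)
    where
    bottom : ∀ B → B ≤ A → suc A + B + m ≡ suc (length ν) →
             IsBallot (A + B) B (suc k) (countᵇ (hasInv k) (atPred (m + B) (fillings ν (suc (m + A)))))
    bottom zero    _   _   = cong (countᵇ (hasInv k)) (atPred-fillings-short ν (≤-reflexive (+-identityʳ m)))
    bottom (suc B) B<A len rewrite +-suc m B =
      subst₂ (λ n p → IsBallot n B k (countS ν p (m + B) k)) (sym (+-suc A B)) (+-suc m A)
        (ih (suc A) B k (≤-trans (n≤1+n B) (m≤n⇒m≤1+n B<A))
            (trans (cong (_+ m) (sym (+-suc A B))) (suc-injective len)))

  ballotCounts-1∷-diagonal : ∀ A k → A + A + m ≡ suc (length ν) →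
    IsBallot (A + A) A k (countS (1 ∷ ν) (m + A) (m + A) k)
  ballotCounts-1∷-diagonal zero    k len = contradiction (countᵇ≤length _ ν) (<⇒≱ (≤-reflexive (sym len)))
  ballotCounts-1∷-diagonal (suc A) k len rewrite +-suc m A | countS-1-diagonal ν k (m + A) =
    subst (λ n → IsBallot n (suc A) k (countᵇ (hasSucInv k) F + countS ν (suc (m + A)) (m + A) k))
      (cong suc (sym (+-suc A A))) (IsBallot-pascal (suc A) k (shifted k) (unshifted k))
    where
    unshifted : ∀ k → IsBallot (suc A + A) A k (countS ν (suc (m + A)) (m + A) k)
    unshifted k = subst (λ p → IsBallot (suc A + A) A k (countS ν p (m + A) k)) (+-suc m A)
      (ih (suc A) A k (n≤1+n A) (trans (cong (_+ m) (sym (+-suc A A))) (suc-injective len)))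
    F = fillings ν (suc (m + A)) (m + A)
    shifted : ∀ k → IsBallot (suc A + A) (suc A) k (countᵇ (hasSucInv k) F)
    shifted zero    = subst (Ballot (suc A + A) (suc A)) (sym (countᵇ-none (All.universal (λ _ → refl) F)))
                            (Ballot-middle A)
    shifted (suc k) = unshifted k

  ballotCounts-1∷ : BallotCounts (1 ∷ ν)
  ballotCounts-1∷ A B k B≤A len with m≤n⇒m<n∨m≡n B≤A
  ... | inj₁ (s≤s B≤A′) = ballotCounts-1∷-below-diagonal _ B k B≤A′ len
  ... | inj₂ refl       = ballotCounts-1∷-diagonal B k len

countS-isBallot : ∀ ν → OnesAndTwos ν → BallotCounts ν
countS-isBallot []      []                  = ballotCounts-[]
countS-isBallot (_ ∷ ν) (inj₁ refl ∷ ν12)   = ballotCounts-1∷ {ν} (countS-isBallot ν ν12)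
countS-isBallot (_ ∷ ν) (inj₂ refl ∷ ν12)   = ballotCounts-2∷ {ν} (countS-isBallot ν ν12)

binomZ-⊖-< : ∀ n {B k} → B < k → binomZ n (B ⊖ k) ≡ 0
binomZ-⊖-< n {B} {k} B<k rewrite ⊖-< B<k with k ∸ B in eq
... | zero  = contradiction (subst (0 <_) eq (m<n⇒0<n∸m B<k)) λ ()
... | suc _ = refl

IsBallot⇒formula : ∀ {A B k c} → B ≤ A → IsBallot (A + B) B k c →
                   c * (A + 1 + k) ≡ (A ∸ B + 1 + 2 * k) * binomZ (A + B) (B ⊖ k)
IsBallot⇒formula {A} {B} {k} {c} B≤A ib with k ≤? B
... | no k≰B rewrite IsBallot-below B k (≰⇒> k≰B) ib | binomZ-⊖-< (A + B) (≰⇒> k≰B) = sym (*-zeroʳ (A ∸ B + 1 + 2 * k))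
... | yes k≤B with m≤n⇒∃[o]m+o≡n k≤B | m≤n⇒∃[o]m+o≡n B≤A
...   | r , refl | d , refl
  rewrite m+n∸m≡n (k + r) d | ⊖-≥ (m≤m+n k r) | m+n∸m≡n k r = begin
  c * (k + r + d + 1 + k)                   ≡⟨ cong (c *_) (factor k r d) ⟩
  c * suc (r + D)                           ≡⟨ Ballot-closed r D ballot ⟩
  suc D * ((r + r + D) C r)                 ≡⟨ cong₂ (λ u n → u * (n C r)) (slope d k) (size k r d) ⟨
  (d + 1 + 2 * k) * ((k + r + d + (k + r)) C r) ∎
  where
  open ≡-Reasoning
  D = d + 2 * k
  size : ∀ k r d → k + r + d + (k + r) ≡ r + r + (d + 2 * k)
  size = solve-∀
  ballot : Ballot (r + r + D) r c
  ballot = subst (λ n → Ballot n r c) (size k r d) (IsBallot-above k ib)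
  factor : ∀ k r d → k + r + d + 1 + k ≡ suc (r + (d + 2 * k))
  factor = solve-∀
  slope : ∀ d k → d + 1 + 2 * k ≡ suc (d + 2 * k)
  slope = solve-∀

countS-formula : ∀ ν → OnesAndTwos ν → ∀ {a b k} → b ≤ a → twos ν + length ν ≡ a + b →
  countS ν a b k * (a + 1 + k ∸ twos ν)
    ≡ (a ∸ b + 1 + 2 * k) * binomZ (a + b ∸ 2 * twos ν) (ℤ.+ b ℤ.- ℤ.+ (k + twos ν))
countS-formula ν ν12 {a} {b} {k} b≤a size with twos ν ≤? b
... | no m≰b
  rewrite fillings-short ν {a} (≰⇒> m≰b) | [+m]-[+n]≡m⊖n b (k + twos ν)
        | binomZ-⊖-< (a + b ∸ 2 * twos ν) (<-≤-trans (≰⇒> m≰b) (m≤n+m (twos ν) k)) =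
  sym (*-zeroʳ (a ∸ b + 1 + 2 * k))
... | yes m≤b with m≤n⇒∃[o]m+o≡n m≤b | m≤n⇒∃[o]m+o≡n (≤-trans m≤b b≤a)
...   | B , refl | A , refl = begin
  countS ν (m + A) (m + B) k * (m + A + 1 + k ∸ m)
    ≡⟨ cong (countS ν (m + A) (m + B) k *_) (cancel m (A + 1 + k) (assoc m A k)) ⟩
  countS ν (m + A) (m + B) k * (A + 1 + k)
    ≡⟨ IsBallot⇒formula {k = k} B≤A (countS-isBallot ν ν12 A B k B≤A len) ⟩
  (A ∸ B + 1 + 2 * k) * binomZ (A + B) (B ⊖ k)
    ≡⟨ cong₂ (λ d n → (d + 1 + 2 * k) * binomZ n (B ⊖ k))
             ([m+n]∸[m+o]≡n∸o m A B) (cancel (2 * m) (A + B) (double m A B)) ⟨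
  (m + A ∸ (m + B) + 1 + 2 * k) * binomZ (m + A + (m + B) ∸ 2 * m) (B ⊖ k)
    ≡⟨ cong (λ z → (m + A ∸ (m + B) + 1 + 2 * k) * binomZ (m + A + (m + B) ∸ 2 * m) z) (offset m B k) ⟨
  (m + A ∸ (m + B) + 1 + 2 * k) * binomZ (m + A + (m + B) ∸ 2 * m) (ℤ.+ (m + B) ℤ.- ℤ.+ (k + m)) ∎
  where
  open ≡-Reasoning
  m = twos ν
  B≤A : B ≤ A
  B≤A = +-cancelˡ-≤ m B A b≤a
  regroup : ∀ m A B → m + (A + B + m) ≡ m + A + (m + B)
  regroup = solve-∀
  len : A + B + m ≡ length ν
  len = +-cancelˡ-≡ m _ _ (trans (regroup m A B) (sym size))
  cancel : ∀ m n {x} → x ≡ m + n → x ∸ m ≡ n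
  cancel m n refl = m+n∸m≡n m n
  assoc : ∀ m A k → m + A + 1 + k ≡ m + (A + 1 + k)
  assoc = solve-∀
  double : ∀ m A B → m + A + (m + B) ≡ 2 * m + (A + B)
  double = solve-∀
  offset : ∀ m B k → ℤ.+ (m + B) ℤ.- ℤ.+ (k + m) ≡ B ⊖ k
  offset m B k = trans ([+m]-[+n]≡m⊖n (m + B) (k + m)) (trans (cong ((m + B) ⊖_) (+-comm k m)) (+-cancelˡ-⊖ m B k))

length-≡-unique : ∀ {A : Set} {xs ys : List A} → Unique xs → Unique ys →
                  (∀ {x} → x ∈ xs → x ∈ ys) → (∀ {x} → x ∈ ys → x ∈ xs) → length xs ≡ length ys
length-≡-unique xs! ys! ⊆ ⊇ = ↭-length (∼bag⇒↭ (unique∧set⇒bag xs! ys! (mk⇔ ⊆ ⊇)))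

concatMap-unique : ∀ {A B : Set} (f : A → List B) {xs} → Unique xs → (∀ x → Unique (f x)) →
                   (∀ {x y} → x ≢ y → Disjoint (f x) (f y)) → Unique (concatMap f xs)
concatMap-unique f xs! f! f# = Unique.concat⁺ (All.map⁺ (All.universal f! _)) (AllPairs.map⁺ (AllPairs.map f# xs!))

allLists-unique : ∀ M n → Unique (allLists M n)
allLists-unique M zero    = [] ∷ []
allLists-unique M (suc n) =
  concatMap-unique _ (Unique.map⁺ suc-injective (Unique.upTo⁺ M))
    (λ v → Unique.map⁺ (proj₂ ∘ ∷-injective) (allLists-unique M n))
    (λ v≢w (x∈v , x∈w) → disjoint v≢w x∈v x∈w)
  where
  disjoint : ∀ {v w x} → v ≢ w → x ∈ map (v ∷_) (allLists M n) → x ∈ map (w ∷_) (allLists M n) → ⊥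
  disjoint v≢w x∈v x∈w with ∈-map⁻ _ x∈v | ∈-map⁻ _ x∈w
  ... | _ , _ , refl | _ , _ , eq = v≢w (proj₁ (∷-injective eq))

∈-allLists⁺ : ∀ M xs → InRange M xs → xs ∈ allLists M (length xs)
∈-allLists⁺ M []           []                 = here refl
∈-allLists⁺ M (suc v ∷ xs) ((_ , v<M) ∷ rng) =
  ∈-concatMap⁺ (λ w → map (w ∷_) (allLists M (length xs)))
    (lose (∈-map⁺ suc (∈-upTo⁺ v<M)) (∈-map⁺ (suc v ∷_) (∈-allLists⁺ M xs rng)))

∈-allLists⁻ : ∀ M n xs → xs ∈ allLists M n → length xs ≡ n × InRange M xs
∈-allLists⁻ M zero    xs (here refl) = refl , []
∈-allLists⁻ M (suc n) xs xs∈
  with find (∈-concatMap⁻ (λ v → map (v ∷_) (allLists M n)) {xs = map suc (upTo M)} xs∈)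
... | v , v∈ , xs∈v with ∈-map⁻ (v ∷_) xs∈v | ∈-map⁻ suc v∈
...   | ys , ys∈ , refl | i , i∈ , refl =
  cong suc (proj₁ (∈-allLists⁻ M n ys ys∈)) , (s≤s z≤n , ∈-upTo⁻ i∈) ∷ proj₂ (∈-allLists⁻ M n ys ys∈)

module _ (a b : ℕ) (μ : List ℕ) where
  private
    M = length μ
    pairWith : List ℕ → List Filling
    pairWith t = map (t ,_) (allLists M b)

  candidates-unique : Unique (candidates a b μ)
  candidates-unique =
    concatMap-unique pairWith (allLists-unique M a) (λ t → Unique.map⁺ (cong proj₂) (allLists-unique M b))
      (λ t≢t′ (x∈ , x∈′) → disjoint t≢t′ x∈ x∈′)
    where
    disjoint : ∀ {t t′ x} → t ≢ t′ → x ∈ pairWith t → x ∈ pairWith t′ → ⊥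
    disjoint t≢t′ x∈ x∈′ with ∈-map⁻ _ x∈ | ∈-map⁻ _ x∈′
    ... | _ , _ , refl | _ , _ , eq = t≢t′ (cong proj₁ eq)

  ∈-candidates⁺ : ∀ {t s} → t ∈ allLists M a → s ∈ allLists M b → (t , s) ∈ candidates a b μ
  ∈-candidates⁺ {t} t∈ s∈ = ∈-concatMap⁺ pairWith (lose t∈ (∈-map⁺ (t ,_) s∈))

  ∈-candidates⁻ : ∀ {t s} → (t , s) ∈ candidates a b μ → t ∈ allLists M a × s ∈ allLists M b
  ∈-candidates⁻ x∈ with find (∈-concatMap⁻ pairWith {xs = allLists M a} x∈)
  ... | t , t∈ , x∈t with ∈-map⁻ (t ,_) x∈t
  ...   | s , s∈ , refl = t∈ , s∈

contentFrom-snoc : ∀ v ms c xs → contentFrom v (ms ++ c ∷ []) xs ≡ contentFrom v ms xs ∧ (occ (v + length ms) xs ≡ᵇ c)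
contentFrom-snoc v []       c xs rewrite +-identityʳ v = ∧-identityʳ (occ v xs ≡ᵇ c)
contentFrom-snoc v (n ∷ ms) c xs rewrite contentFrom-snoc (suc v) ms c xs | +-suc v (length ms) =
  sym (∧-assoc (occ v xs ≡ᵇ n) _ _)

hasContent⇒HasContent : ∀ ν {t s} → hasContent (reverse ν) (t ++ s) ≡ true → HasContent ν (t , s)
hasContent⇒HasContent []      _ = tt
hasContent⇒HasContent (c ∷ ν) {t} {s} h
  rewrite unfold-reverse c ν | contentFrom-snoc 1 (reverse ν) c (t ++ s) | length-reverse ν =
  let h′ , occ≡c = ∧≡true⁻ {contentFrom 1 (reverse ν) (t ++ s)} h
  in trans (sym (occ-++ _ t s)) (≡ᵇ≡true⇒≡ occ≡c) , hasContent⇒HasContent ν h′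

HasContent⇒hasContent : ∀ ν {t s} → HasContent ν (t , s) → hasContent (reverse ν) (t ++ s) ≡ true
HasContent⇒hasContent []      _ = refl
HasContent⇒hasContent (c ∷ ν) {t} {s} (occ≡c , h)
  rewrite unfold-reverse c ν | contentFrom-snoc 1 (reverse ν) c (t ++ s) | length-reverse ν =
  ∧≡true⁺ (HasContent⇒hasContent ν h) (≡⇒≡ᵇ≡true (trans (occ-++ _ t s) occ≡c))

module _ (k a b : ℕ) (μ : List ℕ) where
  private
    ν = reverse μ
    M = length μ
    M≡ : M ≡ length ν
    M≡ = sym (length-reverse μ)
    μ≡ : μ ≡ reverse ν
    μ≡ = sym (reverse-involutive μ)

  inS⇒IsFilling : ∀ {t s} → (t , s) ∈ candidates a b μ → isInS k μ (t , s) ≡ true →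
                  IsFilling ν a b (t , s) × hasInv k (t , s) ≡ true
  inS⇒IsFilling {t} {s} x∈ inS =
    let inc-t , inS′  = ∧≡true⁻ {strictInc t} inS
        inc-s , inS″  = ∧≡true⁻ {strictInc s} inS′
        content , inv = ∧≡true⁻ {hasContent μ (t ++ s)} inS″
        t∈ , s∈       = ∈-candidates⁻ a b μ x∈
        lt , rng-t    = ∈-allLists⁻ M a t t∈
        ls , rng-s    = ∈-allLists⁻ M b s s∈
    in filling lt ls (row (subst (λ M → InRange M t) M≡ rng-t) inc-t) (row (subst (λ M → InRange M s) M≡ rng-s) inc-s)
         (hasContent⇒HasContent ν (subst (λ μ → hasContent μ (t ++ s) ≡ true) μ≡ content)) ,
       inv

  IsFilling⇒inS : ∀ {t s} → IsFilling ν a b (t , s) → hasInv k (t , s) ≡ true →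
                  (t , s) ∈ candidates a b μ × isInS k μ (t , s) ≡ true
  IsFilling⇒inS {t} {s} (filling refl refl (row rng-t inc-t) (row rng-s inc-s) content) inv =
    ∈-candidates⁺ (length t) (length s) μ
      (∈-allLists⁺ M t (subst (λ M → InRange M t) (sym M≡) rng-t))
      (∈-allLists⁺ M s (subst (λ M → InRange M s) (sym M≡) rng-s)) ,
    ∧≡true⁺ inc-t (∧≡true⁺ inc-s (∧≡true⁺ (subst (λ μ → hasContent μ (t ++ s) ≡ true) (sym μ≡)
                                             (HasContent⇒hasContent ν content)) inv))

cardS≡countS : ∀ k a b μ → OnesAndTwos μ → cardS k a b μ ≡ countS (reverse μ) a b k
cardS≡countS k a b μ μ12 =
  trans (length-≡-unique (Unique.filter⁺ (T? ∘ isInS k μ) (candidates-unique a b μ))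
                         (Unique.filter⁺ (T? ∘ hasInv k) (fillings-unique ν a b)) ⊆ ⊇)
        (length-filterᵇ (hasInv k) (fillings ν a b))
  where
  ν = reverse μ
  ⊆ : ∀ {x} → x ∈ filterᵇ (isInS k μ) (candidates a b μ) → x ∈ filterᵇ (hasInv k) (fillings ν a b)
  ⊆ {t , s} x∈ =
    let x∈c , inS = ∈-filter⁻ (T? ∘ isInS k μ) x∈
        f , inv   = inS⇒IsFilling k a b μ x∈c (to T-≡ inS)
    in ∈-filter⁺ (T? ∘ hasInv k) (fillings-complete ν (All-reverse μ12) f) (from T-≡ inv)
  ⊇ : ∀ {x} → x ∈ filterᵇ (hasInv k) (fillings ν a b) → x ∈ filterᵇ (isInS k μ) (candidates a b μ)
  ⊇ {t , s} x∈ =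
    let x∈f , inv = ∈-filter⁻ (T? ∘ hasInv k) x∈
        x∈c , inS = IsFilling⇒inS k a b μ (All.lookup (fillings-sound ν a b) x∈f) (to T-≡ inv)
    in ∈-filter⁺ (T? ∘ isInS k μ) x∈c (from T-≡ inS)

sum-onesAndTwos : ∀ {μ} → OnesAndTwos μ → sum μ ≡ twos μ + length μ
sum-onesAndTwos []                      = refl
sum-onesAndTwos {_ ∷ μ} (inj₁ refl ∷ μ12) =
  trans (cong suc (sum-onesAndTwos μ12)) (sym (+-suc (twos μ) (length μ)))
sum-onesAndTwos {_ ∷ μ} (inj₂ refl ∷ μ12) =
  cong suc (trans (cong suc (sum-onesAndTwos μ12)) (sym (+-suc (twos μ) (length μ))))

mainTheorem4 : (a b m k : ℕ) (μ : List ℕ) →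
    b ≤ a → 1 ≤ b →
    All (λ x → x ≡ 1 ⊎ x ≡ 2) μ →
    sum μ ≡ a + b →
    numTwos μ ≡ m →
    cardS k a b μ * (a + 1 + k ∸ m)
    ≡ (a ∸ b + 1 + 2 * k) * binomZ (a + b ∸ 2 * m) (ℤ.+ b ℤ.- ℤ.+ (k + m))
mainTheorem4 a b m k μ b≤a _ μ12 Σμ refl
  rewrite cardS≡countS k a b μ μ12 | length-filterᵇ (_≡ᵇ 2) μ | sym (countᵇ-reverse (_≡ᵇ 2) μ) =
  countS-formula (reverse μ) (All-reverse μ12) b≤a size
  where
  size : twos (reverse μ) + length (reverse μ) ≡ a + b
  size = trans (cong₂ _+_ (countᵇ-reverse (_≡ᵇ 2) μ) (length-reverse μ)) (trans (sym (sum-onesAndTwos μ12)) Σμ)
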